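{- For any integers $n \geq 3$ and $m \geq 2$, \[\mu_s(C_n + \overline{K_m}) \geq \left\lfloor\tfrac{1}{2}(m+1)n\right\rfloor - (n+m) + 2.\]
   Context: All graphs are finite and simple. For a graph $G$ with $p=|V(G)|$ vertices and $q=|E(G)|$ edges, a super edge-magic labeling is a bijection $f: V(G)\cup E(G)\to\{1,2,\ldots,p+q\}$ with $f(V(G))=\{1,\ldots,p\}$ such that $f(x)+f(xy)+f(y)$ is the same constant for every edge $xy$; $G$ is super edge-magic if it has such a labeling. The super edge-magic deficiency $\mu_s(G)$ is the minimum nonnegative integer $t$ such that $G\cup tK_1$ (disjoint union of $G$ with $t$ isolated vertices) is super edge-magic, or $+\infty$ if no such $t$ exists. The join $G_1+G_2$ of two vertex-disjoint graphs is their union together with all edges joining a vertex of $G_1$ to a vertex of $G_2$. $C_n$ is the cycle on $n$ vertices and $\overline{K_m}$ is the graph with $m$ vertices and no edges. -}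

module Defs where

open import Data.Nat using (ℕ; zero; suc; _+_; _*_; _∸_; _≤_; _<_; _≡ᵇ_)
open import Data.Nat.DivMod using (_/_)
open import Data.Bool using (Bool; true; false; _∧_; _∨_)
open import Data.Fin using (Fin; toℕ; splitAt)
open import Data.Sum using (_⊎_; inj₁; inj₂)
open import Data.Product using (Σ; ∃; _×_; _,_)
open import Relation.Binary.PropositionalEquality using (_≡_)
open import Function.Bundles using (_⤖_; Bijection)

-- A finite simple graph on vertex set Fin V, given by a (symmetric,
-- irreflexive for all graphs built below) Boolean adjacency function.
record Graph : Set where
  field
    V   : ℕ
    adj : Fin V → Fin V → Bool
open Graph public

-- Edges: unordered pairs {u,v}, represented once as u < v with adj u v.
Edge : Graph → Set
Edge G = Σ (Fin (V G)) λ u → Σ (Fin (V G)) λ v → (toℕ u < toℕ v) × (adj G u v ≡ true)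

cycleAdj : ℕ → ℕ → ℕ → Bool
cycleAdj n i j = (suc i ≡ᵇ j) ∨ (suc j ≡ᵇ i)
               ∨ ((i ≡ᵇ (n ∸ 1)) ∧ (j ≡ᵇ 0)) ∨ ((j ≡ᵇ (n ∸ 1)) ∧ (i ≡ᵇ 0))

Cycle : ℕ → Graph
Cycle n = record { V = n ; adj = λ i j → cycleAdj n (toℕ i) (toℕ j) }

Empty : ℕ → Graph
Empty m = record { V = m ; adj = λ _ _ → false }

_∪G_ : Graph → Graph → Graph
G ∪G H = record { V = V G + V H ; adj = a }
  where
  a : Fin (V G + V H) → Fin (V G + V H) → Bool
  a x y with splitAt (V G) x | splitAt (V G) y
  ... | inj₁ u | inj₁ v = adj G u v
  ... | inj₂ u | inj₂ v = adj H u v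
  ... | inj₁ _ | inj₂ _ = false
  ... | inj₂ _ | inj₁ _ = false

_+G_ : Graph → Graph → Graph
G +G H = record { V = V G + V H ; adj = a }
  where
  a : Fin (V G + V H) → Fin (V G + V H) → Bool
  a x y with splitAt (V G) x | splitAt (V G) y
  ... | inj₁ u | inj₁ v = adj G u v
  ... | inj₂ u | inj₂ v = adj H u v
  ... | inj₁ _ | inj₂ _ = true
  ... | inj₂ _ | inj₁ _ = true

-- Super edge-magic labeling of G with q = |E(G)| edges: a bijection
-- V ∪ E → {1,…,p+q} sending V onto {1,…,p}, hence E onto {p+1,…,p+q}.
record SuperEdgeMagicLabeling (G : Graph) : Set where
  field
    q  : ℕ
    fv : Fin (V G) ⤖ Fin (V G)
    fe : Edge G ⤖ Fin q
    k  : ℕ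
  vlab : Fin (V G) → ℕ
  vlab x = suc (toℕ (Bijection.to fv x))
  elab : Edge G → ℕ
  elab e = V G + suc (toℕ (Bijection.to fe e))
  field
    magic : (e : Edge G) → let (u , v , _) = e in vlab u + elab e + vlab v ≡ k

SuperEdgeMagic : Graph → Set
SuperEdgeMagic G = SuperEdgeMagicLabeling G

-- μ_s(G) ≥ b  :⇔  G ∪ tK_1 super edge-magic implies b ≤ t (covers μ_s = +∞).
μs≥ : Graph → ℕ → Set
μs≥ G b = (t : ℕ) → SuperEdgeMagic (G ∪G Empty t) → b ≤ t

-- The graph (C_n + \overline{K_m}) ∪ tK_1 has p = n + m + t vertices and at
-- least n + nm edges. In a super edge-magic labeling the sum of the two
-- vertex labels of an edge plus its edge label is constant, so the q edges
-- have q consecutive vertex sums; these sums of two distinct labels from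
-- {1, …, p} lie in [3, 2p − 1], whence q ≤ 2p − 3. Thus n + nm + 3 ≤ 2p, and
-- halving gives ⌊(m + 1)n / 2⌋ + 2 ≤ n + m + t.
module Submission where

open import Defs
open import Data.Nat using (ℕ; _+_; _*_; _∸_; _≤_)
open import Data.Nat.DivMod using (_/_)
open import Data.Nat as ℕ using (suc; _<_; _≡ᵇ_; s≤s; z≤n; s≤s⁻¹)
open import Data.Nat.Properties
open import Data.Nat.DivMod using (m/n*n≤m)
open import Data.Nat.Tactic.RingSolver using (solve-∀)
open import Data.Bool using (true; _∧_)
open import Data.Bool.Properties using (∨-zeroʳ; T-≡)
open import Data.Fin as Fin using (Fin; toℕ; _↑ˡ_; _↑ʳ_; inject₁; fromℕ; fromℕ<)
open import Data.Fin.Properties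
  using (splitAt-↑ˡ; splitAt-↑ʳ; toℕ-↑ˡ; toℕ-↑ʳ; toℕ-inject₁; toℕ-fromℕ; toℕ-fromℕ<;
         toℕ-injective; toℕ<n; injective⇒≤; +↔⊎; *↔×)
open import Data.Sum using (_⊎_; inj₁; inj₂)
open import Data.Sum.Function.Propositional using (_⊎-↔_)
open import Data.Product using (_×_; _,_; proj₁; proj₂)
open import Data.Product.Properties using (,-injectiveˡ; ,-injectiveʳ)
open import Relation.Nullary using (contradiction)
open import Relation.Binary.Definitions using (tri<; tri≈; tri>)
open import Relation.Binary.PropositionalEquality
open import Function using (_∘_)
open import Function.Bundles using (Bijection; Injection; Inverse; Equivalence; _↔_)
open import Function.Definitions using (Injective)
open import Function.Construct.Composition using (_↔-∘_)
open import Function.Construct.Identity using (↔-id)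
open import Function.Properties.Inverse using (↔⇒↣)

private
  variable
    G H : Graph

endpoints : Edge G → ℕ × ℕ
endpoints (u , v , _) = toℕ u , toℕ v

sum-of-ordered-bounds : ∀ {a b p} → a < b → b < p → 3 ≤ suc a + suc b × suc a + suc b < p + p
sum-of-ordered-bounds a<b b<p =
  +-mono-≤ (s≤s z≤n) (s≤s (<-≤-trans (s≤s z≤n) a<b)) ,
  +-mono-≤ (≤-trans (s≤s a<b) b<p) (<-≤-trans b<p ≤-refl)

sum-of-distinct-bounds : ∀ {a b p} → a ≢ b → a < p → b < p → 3 ≤ suc a + suc b × suc a + suc b < p + p
sum-of-distinct-bounds {a} {b} a≢b a<p b<p with <-cmp a b
... | tri< a<b _ _ = sum-of-ordered-bounds a<b b<p
... | tri≈ _ a≡b _ = contradiction a≡b a≢b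
... | tri> _ _ b<a rewrite +-comm (suc a) (suc b) = sum-of-ordered-bounds b<a a<p

module _ (L : SuperEdgeMagicLabeling G) where
  open SuperEdgeMagicLabeling L
  open Bijection using (to; injective; strictlySurjective)

  vertexSum : Edge G → ℕ
  vertexSum (u , v , _) = vlab u + vlab v

  edgeIndex : Edge G → ℕ
  edgeIndex e = toℕ (to fe e)

  vertexSum-bounds : ∀ e → 3 ≤ vertexSum e × vertexSum e < V G + V G
  vertexSum-bounds (u , v , u<v , _) = sum-of-distinct-bounds labels≢ (toℕ<n _) (toℕ<n _)
    where
    labels≢ : toℕ (to fv u) ≢ toℕ (to fv v)
    labels≢ = <⇒≢ u<v ∘ cong toℕ ∘ injective fv ∘ toℕ-injective

  edgeIndex+vertexSum≡ : ∀ e → suc (V G) + (edgeIndex e + vertexSum e) ≡ k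
  edgeIndex+vertexSum≡ e@(u , v , _) =
    trans (regroup (vlab u) (vlab v) (V G) (edgeIndex e)) (magic e)
    where
    regroup : ∀ a b p i → suc p + (i + (a + b)) ≡ a + (p + suc i) + b
    regroup = solve-∀

  edgeIndex+vertexSum-constant : ∀ e e′ → edgeIndex e + vertexSum e ≡ edgeIndex e′ + vertexSum e′
  edgeIndex+vertexSum-constant e e′ =
    +-cancelˡ-≡ (suc (V G)) _ _ (trans (edgeIndex+vertexSum≡ e) (sym (edgeIndex+vertexSum≡ e′)))

  -- The edge of index 0 has the largest vertex sum, and that is below 2p.
  i<q⇒i+3<p+p : ∀ {i} → i < q → i + 3 < V G + V G
  i<q⇒i+3<p+p {i} i<q = begin-strict
    i + 3                        ≤⟨ +-monoʳ-≤ i (proj₁ (vertexSum-bounds eᵢ)) ⟩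
    i + vertexSum eᵢ             ≡⟨ cong (_+ vertexSum eᵢ) (sym (indexOf i<q)) ⟩
    edgeIndex eᵢ + vertexSum eᵢ  ≡⟨ edgeIndex+vertexSum-constant eᵢ e₀ ⟩
    edgeIndex e₀ + vertexSum e₀  ≡⟨ cong (_+ vertexSum e₀) (indexOf 0<q) ⟩
    vertexSum e₀                 <⟨ proj₂ (vertexSum-bounds e₀) ⟩
    V G + V G                    ∎
    where
    open ≤-Reasoning
    edgeWithIndex : ∀ {j} → j < q → Edge G
    edgeWithIndex j<q = proj₁ (strictlySurjective fe (fromℕ< j<q))
    indexOf : ∀ {j} (j<q : j < q) → edgeIndex (edgeWithIndex j<q) ≡ j
    indexOf j<q = trans (cong toℕ (proj₂ (strictlySurjective fe (fromℕ< j<q)))) (toℕ-fromℕ< j<q)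
    0<q : 0 < q
    0<q = <-≤-trans (s≤s z≤n) i<q
    eᵢ e₀ : Edge G
    eᵢ = edgeWithIndex i<q
    e₀ = edgeWithIndex 0<q

  injective⇒≤q : ∀ {N} {e : Fin N → Edge G} → Injective _≡_ _≡_ (endpoints ∘ e) → N ≤ q
  injective⇒≤q {e = e} inj =
    injective⇒≤ {f = to fe ∘ e} λ eq → inj (cong endpoints (injective fe eq))

≡ᵇ-refl : ∀ i → (i ≡ᵇ i) ≡ true
≡ᵇ-refl i = Equivalence.to T-≡ (≡⇒≡ᵇ i i refl)

cycleAdj-suc : ∀ n i → cycleAdj n i (suc i) ≡ true
cycleAdj-suc n i rewrite ≡ᵇ-refl i = refl

cycleAdj-0-last : ∀ n → cycleAdj (suc n) 0 n ≡ true
cycleAdj-0-last n rewrite ≡ᵇ-refl n | ∨-zeroʳ ((0 ≡ᵇ n) ∧ (n ≡ᵇ 0)) = ∨-zeroʳ (1 ≡ᵇ n)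

cycleEdge : ∀ k → Fin (3 + k) → Edge (Cycle (3 + k))
cycleEdge k Fin.zero =
  Fin.zero , fromℕ (2 + k) , s≤s z≤n ,
  subst (λ j → cycleAdj (3 + k) 0 j ≡ true) (sym (toℕ-fromℕ (2 + k))) (cycleAdj-0-last (2 + k))
cycleEdge k (Fin.suc i) =
  inject₁ i , Fin.suc i , s≤s (≤-reflexive (toℕ-inject₁ i)) ,
  subst (λ j → cycleAdj (3 + k) j (suc (toℕ i)) ≡ true) (sym (toℕ-inject₁ i))
    (cycleAdj-suc (3 + k) (toℕ i))

cycleEdge-0≢suc : ∀ k j → endpoints (cycleEdge k Fin.zero) ≢ endpoints (cycleEdge k (Fin.suc j))
cycleEdge-0≢suc k j eq = 1+n≢0 (trans (suc-injective 2+k≡1+j) j≡0)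
  where
  j≡0 : toℕ j ≡ 0
  j≡0 = trans (sym (toℕ-inject₁ j)) (sym (,-injectiveˡ eq))
  2+k≡1+j : 2 + k ≡ suc (toℕ j)
  2+k≡1+j = trans (sym (toℕ-fromℕ (2 + k))) (,-injectiveʳ eq)

cycleEdge-injective : ∀ k → Injective _≡_ _≡_ (endpoints ∘ cycleEdge k)
cycleEdge-injective k {Fin.zero}  {Fin.zero}  _  = refl
cycleEdge-injective k {Fin.zero}  {Fin.suc j} eq = contradiction eq (cycleEdge-0≢suc k j)
cycleEdge-injective k {Fin.suc i} {Fin.zero}  eq = contradiction (sym eq) (cycleEdge-0≢suc k i)
cycleEdge-injective k {Fin.suc i} {Fin.suc j} eq =
  cong Fin.suc (toℕ-injective (suc-injective (,-injectiveʳ eq)))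

adj-∪-↑ˡ : ∀ G H x y → adj (G ∪G H) (x ↑ˡ V H) (y ↑ˡ V H) ≡ adj G x y
adj-∪-↑ˡ G H x y rewrite splitAt-↑ˡ (V G) x (V H) | splitAt-↑ˡ (V G) y (V H) = refl

adj-+-↑ˡ : ∀ G H x y → adj (G +G H) (x ↑ˡ V H) (y ↑ˡ V H) ≡ adj G x y
adj-+-↑ˡ G H x y rewrite splitAt-↑ˡ (V G) x (V H) | splitAt-↑ˡ (V G) y (V H) = refl

adj-+-↑ˡ-↑ʳ : ∀ G H x y → adj (G +G H) (x ↑ˡ V H) (V G ↑ʳ y) ≡ true
adj-+-↑ˡ-↑ʳ G H x y rewrite splitAt-↑ˡ (V G) x (V H) | splitAt-↑ʳ (V G) (V H) y = refl

↑ˡ-mono-< : ∀ {m} n {u v : Fin m} → toℕ u < toℕ v → toℕ (u ↑ˡ n) < toℕ (v ↑ˡ n)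
↑ˡ-mono-< n {u} {v} = subst₂ _<_ (sym (toℕ-↑ˡ u n)) (sym (toℕ-↑ˡ v n))

∪ˡ-edge : Edge G → Edge (G ∪G H)
∪ˡ-edge {G} {H} (u , v , u<v , uv) =
  u ↑ˡ V H , v ↑ˡ V H , ↑ˡ-mono-< (V H) u<v , trans (adj-∪-↑ˡ G H u v) uv

+ˡ-edge : Edge G → Edge (G +G H)
+ˡ-edge {G} {H} (u , v , u<v , uv) =
  u ↑ˡ V H , v ↑ˡ V H , ↑ˡ-mono-< (V H) u<v , trans (adj-+-↑ˡ G H u v) uv

+-crossEdge : Fin (V G) → Fin (V H) → Edge (G +G H)
+-crossEdge {G} {H} u v = u ↑ˡ V H , V G ↑ʳ v , u<G+v , adj-+-↑ˡ-↑ʳ G H u v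
  where
  u<G+v : toℕ (u ↑ˡ V H) < toℕ (V G ↑ʳ v)
  u<G+v = subst₂ _<_ (sym (toℕ-↑ˡ u (V H))) (sym (toℕ-↑ʳ (V G) v))
    (<-≤-trans (toℕ<n u) (m≤m+n (V G) (toℕ v)))

endpoints-∪ˡ-edge : ∀ (e : Edge G) → endpoints (∪ˡ-edge {H = H} e) ≡ endpoints e
endpoints-∪ˡ-edge {H = H} (u , v , _) = cong₂ _,_ (toℕ-↑ˡ u (V H)) (toℕ-↑ˡ v (V H))

endpoints-+ˡ-edge : ∀ (e : Edge G) → endpoints (+ˡ-edge {H = H} e) ≡ endpoints e
endpoints-+ˡ-edge {H = H} (u , v , _) = cong₂ _,_ (toℕ-↑ˡ u (V H)) (toℕ-↑ˡ v (V H))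

endpoints-+-crossEdge : ∀ u v → endpoints (+-crossEdge {G} {H} u v) ≡ (toℕ u , V G + toℕ v)
endpoints-+-crossEdge {G} {H} u v = cong₂ _,_ (toℕ-↑ˡ u (V H)) (toℕ-↑ʳ (V G) v)

+ˡ-edge≢+-crossEdge : ∀ (e : Edge G) u v →
  endpoints (+ˡ-edge {H = H} e) ≢ endpoints (+-crossEdge {G} {H} u v)
+ˡ-edge≢+-crossEdge {G} {H} e@(_ , w , _) u v eq = <⇒≢ w<G+v (,-injectiveʳ eq′)
  where
  eq′ : endpoints e ≡ (toℕ u , V G + toℕ v)
  eq′ = trans (sym (endpoints-+ˡ-edge {H = H} e)) (trans eq (endpoints-+-crossEdge {G} {H} u v))
  w<G+v : toℕ w < V G + toℕ v
  w<G+v = <-≤-trans (toℕ<n w) (m≤m+n (V G) (toℕ v))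

∪ˡ-edge-injective : ∀ {A : Set} {e : A → Edge G} →
  Injective _≡_ _≡_ (endpoints ∘ e) → Injective _≡_ _≡_ (endpoints ∘ ∪ˡ-edge {H = H} ∘ e)
∪ˡ-edge-injective {G} {H} {e = e} inj {x} {y} eq =
  inj (trans (sym (endpoints-∪ˡ-edge {G} {H} (e x))) (trans eq (endpoints-∪ˡ-edge {G} {H} (e y))))

+-edges : ∀ {A : Set} → (A → Edge G) → A ⊎ (Fin (V G) × Fin (V H)) → Edge (G +G H)
+-edges e (inj₁ a)       = +ˡ-edge (e a)
+-edges e (inj₂ (u , v)) = +-crossEdge u v

+-edges-injective : ∀ {A : Set} {e : A → Edge G} →
  Injective _≡_ _≡_ (endpoints ∘ e) → Injective _≡_ _≡_ (endpoints ∘ +-edges {H = H} e)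
+-edges-injective {G} {H} {e = e} inj {inj₁ a} {inj₁ b} eq =
  cong inj₁ (inj (trans (sym (endpoints-+ˡ-edge {G} {H} (e a)))
                        (trans eq (endpoints-+ˡ-edge {G} {H} (e b)))))
+-edges-injective {G} {H} {e = e} inj {inj₁ a} {inj₂ (u , v)} eq =
  contradiction eq (+ˡ-edge≢+-crossEdge {G} {H} (e a) u v)
+-edges-injective {G} {H} {e = e} inj {inj₂ (u , v)} {inj₁ b} eq =
  contradiction (sym eq) (+ˡ-edge≢+-crossEdge {G} {H} (e b) u v)
+-edges-injective {G} {H} inj {inj₂ (u , v)} {inj₂ (u′ , v′)} eq =
  cong₂ (λ x y → inj₂ (x , y))
    (toℕ-injective (,-injectiveˡ eq′))
    (toℕ-injective (+-cancelˡ-≡ (V G) _ _ (,-injectiveʳ eq′)))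
  where
  eq′ : (toℕ u , V G + toℕ v) ≡ (toℕ u′ , V G + toℕ v′)
  eq′ = trans (sym (endpoints-+-crossEdge {G} {H} u v))
              (trans eq (endpoints-+-crossEdge {G} {H} u′ v′))

x/2+2≤p : ∀ x p → x + 3 ≤ p + p → x / 2 + 2 ≤ p
x/2+2≤p x p x+3≤p+p = s≤s⁻¹ (*-cancelʳ-< 2 (x / 2 + 2) (suc p) (begin-strict
  (x / 2 + 2) * 2    ≡⟨ *-distribʳ-+ 2 (x / 2) 2 ⟩
  x / 2 * 2 + 4      ≤⟨ +-monoˡ-≤ 4 (m/n*n≤m x 2) ⟩
  x + 4              ≡⟨ +-suc x 3 ⟩
  suc (x + 3)        ≤⟨ s≤s x+3≤p+p ⟩
  suc (p + p)        <⟨ n<1+n (suc (p + p)) ⟩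
  2 + (p + p)        ≡⟨ cong (2 +_) (sym p*2≡p+p) ⟩
  suc p * 2          ∎))
  where
  open ≤-Reasoning
  p*2≡p+p : p * 2 ≡ p + p
  p*2≡p+p = trans (*-comm p 2) (cong (p +_) (+-identityʳ p))

joinIndex : ∀ n m → Fin (n + n * m) ↔ (Fin n ⊎ (Fin n × Fin m))
joinIndex n m = (↔-id _ ⊎-↔ *↔×) ↔-∘ +↔⊎

lemma5 : (n m : ℕ) → 3 ≤ n → 2 ≤ m →
    μs≥ (Cycle n +G Empty m) (((m + 1) * n) / 2 + 2 ∸ (n + m))
lemma5 n@(suc (suc (suc k))) m (s≤s (s≤s (s≤s _))) _ t L =
  m≤n+o⇒m∸n≤o _ (n + m) (x/2+2≤p ((m + 1) * n) p edgeCount+3≤p+p)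
  where
  p : ℕ
  p = n + m + t
  edges : Fin (n + n * m) → Edge ((Cycle n +G Empty m) ∪G Empty t)
  edges = ∪ˡ-edge ∘ +-edges (cycleEdge k) ∘ Inverse.to (joinIndex n m)
  edges-injective : Injective _≡_ _≡_ (endpoints ∘ edges)
  edges-injective eq = Injection.injective (↔⇒↣ (joinIndex n m))
    (∪ˡ-edge-injective {H = Empty t} {e = +-edges (cycleEdge k)}
      (+-edges-injective {H = Empty m} (cycleEdge-injective k)) eq)
  edgeCount≡ : n + n * m ≡ (m + 1) * n
  edgeCount≡ = sym (trans (*-comm (m + 1) n) (trans (cong (n *_) (+-comm m 1)) (*-suc n m)))
  edgeCount+3≤p+p : (m + 1) * n + 3 ≤ p + p
  edgeCount+3≤p+p = subst (λ x → x + 3 ≤ p + p) edgeCount≡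
    (i<q⇒i+3<p+p L (injective⇒≤q L {e = edges} edges-injective))
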